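{- Let $G$ be a graph with no isolated vertex and $H$ a nontrivial graph with $\gamma_I(H)\ne 3$ or $\gamma(H)\ne 3$. Then: (i) if $\gamma(H)=1$, then $\gamma_I(G\circ H)=\gamma_{(2,1,0)}(G)$; (ii) if $\gamma_2(H)=\gamma(H)=2$, then $\gamma_I(G\circ H)=\gamma_{(2,2,0)}(G)$; (iii) if $\gamma_2(H)>\gamma(H)=2$, then $\gamma_I(G\circ H)=\gamma_{(2,2,1)}(G)$; (iv) if $\gamma(H)\ge 3$, then $\gamma_I(G\circ H)=\gamma_{(2,2,2)}(G)$.
   Context: All graphs are finite and simple; $N(v)$ is the open neighbourhood of $v$, and $f(S)=\sum_{u\in S}f(u)$. For a vector $w=(w_0,\dots,w_l)$ of nonnegative integers with $w_0\ge1$, a function $f:V(G)\to\{0,1,\dots,l\}$ is $w$-dominating if $f(N(v))\ge w_i$ for every vertex $v$ with $f(v)=i$; its weight is $\omega(f)=\sum_v f(v)$, and $\gamma_w(G)$ (written $\gamma_{(w_0,\dots,w_l)}(G)$) is the minimum weight of a $w$-dominating function. The Italian domination number is $\gamma_I=\gamma_{(2,0,0)}$ (a function to $\{0,1,2\}$ with $f(N(v))\ge 2$ whenever $f(v)=0$). $\gamma(H)$ is the domination number, and $\gamma_2(H)$ is the 2-domination number: the minimum size of a set $S$ such that every vertex not in $S$ has at least two neighbours in $S$. The lexicographic product $G\circ H$ has vertex set $V(G)\times V(H)$, with $(u,v)(x,y)$ an edge iff $ux\in E(G)$, or $u=x$ and $vy\in E(H)$. A nontrivial graph has at least two vertices.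 -}

module Defs where

open import Data.Nat using (ℕ; zero; suc; _+_; _*_; _≤_)
open import Data.Bool using (Bool; true; false; _∨_; _∧_; if_then_else_)
open import Data.Fin using (Fin; zero; suc; toℕ; remQuot)
open import Data.Fin.Properties using (_≟_)
open import Data.Vec using (Vec; _∷_; []; lookup)
open import Data.Product using (Σ; _×_; _,_; ∃)
open import Relation.Binary.PropositionalEquality using (_≡_; refl) renaming (sym to ≡-sym)
open import Relation.Nullary using (yes; no)
open import Data.Empty using (⊥-elim)
open import Relation.Nullary.Decidable using (⌊_⌋)

sumFin : (n : ℕ) → (Fin n → ℕ) → ℕ
sumFin zero    f = 0
sumFin (suc n) f = f zero + sumFin n (λ i → f (suc i))

record Graph : Set where
  field
    n      : ℕ
    adj    : Fin n → Fin n → Bool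
    sym    : ∀ u v → adj u v ≡ adj v u
    irrefl : ∀ v → adj v v ≡ false
open Graph public

nbSum : (G : Graph) → (Fin (n G) → ℕ) → Fin (n G) → ℕ
nbSum G f v = sumFin (n G) (λ u → if adj G v u then f u else 0)

NoIsolated : Graph → Set
NoIsolated G = ∀ v → ∃ λ u → adj G v u ≡ true

Nontrivial : Graph → Set
Nontrivial G = 2 ≤ n G

IsMin : {A : Set} → (A → Set) → (A → ℕ) → ℕ → Set
IsMin {A} P size k = (Σ A λ a → P a × size a ≡ k) × (∀ a → P a → k ≤ size a)

weight : (G : Graph) {l : ℕ} → (Fin (n G) → Fin (suc l)) → ℕ
weight G f = sumFin (n G) (λ v → toℕ (f v))

IsWDom : (G : Graph) {l : ℕ} → Vec ℕ (suc l) → (Fin (n G) → Fin (suc l)) → Set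
IsWDom G w f = ∀ v → lookup w (f v) ≤ nbSum G (λ u → toℕ (f u)) v

GammaW : (G : Graph) {l : ℕ} → Vec ℕ (suc l) → ℕ → Set
GammaW G w = IsMin (IsWDom G w) (weight G)

GammaI : Graph → ℕ → Set
GammaI G = GammaW G (2 ∷ 0 ∷ 0 ∷ [])

ind : Bool → ℕ
ind true  = 1
ind false = 0

setSize : (G : Graph) → (Fin (n G) → Bool) → ℕ
setSize G S = sumFin (n G) (λ v → ind (S v))

IsKDomSet : ℕ → (G : Graph) → (Fin (n G) → Bool) → Set
IsKDomSet k G S = ∀ v → S v ≡ false → k ≤ nbSum G (λ u → ind (S u)) v

Gamma : Graph → ℕ → Set
Gamma G = IsMin (IsKDomSet 1 G) (setSize G)

Gamma2 : Graph → ℕ → Set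
Gamma2 G = IsMin (IsKDomSet 2 G) (setSize G)

pairAdj : (G H : Graph) → Fin (n G) × Fin (n H) → Fin (n G) × Fin (n H) → Bool
pairAdj G H (u , v) (x , y) = adj G u x ∨ (⌊ u ≟ x ⌋ ∧ adj H v y)

-- lexicographic product G ∘ H, vertex (u,v) encoded as combine u v : Fin (n G * n H)
lexAdj : (G H : Graph) → Fin (n G * n H) → Fin (n G * n H) → Bool
lexAdj G H i j = pairAdj G H (remQuot {n G} (n H) i) (remQuot {n G} (n H) j)

private
  ≟-sym : ∀ {m} (u x : Fin m) → ⌊ u ≟ x ⌋ ≡ ⌊ x ≟ u ⌋
  ≟-sym u x with u ≟ x | x ≟ u
  ... | yes _ | yes _ = refl
  ... | no _  | no _  = refl
  ... | yes p | no q  = ⊥-elim (q (≡-sym p))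
  ... | no p  | yes q = ⊥-elim (p (≡-sym q))

  ≟-refl : ∀ {m} (u : Fin m) → ⌊ u ≟ u ⌋ ≡ true
  ≟-refl u with u ≟ u
  ... | yes _ = refl
  ... | no p  = ⊥-elim (p refl)

lexSym : (G H : Graph) → ∀ i j → lexAdj G H i j ≡ lexAdj G H j i
lexSym G H i j = pairSym (remQuot {n G} (n H) i) (remQuot {n G} (n H) j)
  where
  pairSym : ∀ p q → pairAdj G H p q ≡ pairAdj G H q p
  pairSym (u , v) (x , y) rewrite sym G u x | ≟-sym u x | sym H v y = refl

lexIrrefl : (G H : Graph) → ∀ i → lexAdj G H i i ≡ false
lexIrrefl G H i = pairIrr (remQuot {n G} (n H) i)
  where
  pairIrr : ∀ p → pairAdj G H p p ≡ false
  pairIrr (u , v) rewrite irrefl G u | ≟-refl u | irrefl H v = refl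

_∘L_ : Graph → Graph → Graph
G ∘L H = record
  { n = n G * n H ; adj = lexAdj G H ; sym = lexSym G H ; irrefl = lexIrrefl G H }

-- Let f be an Italian dominating function of G ∘ H, F(u) its weight on the fibre {u} × V(H)
-- and s(u) the sum of F over the G-neighbours of u, every vertex of which dominates the whole
-- fibre of u. Each fibre is then Italian dominated with outside help s(u), and the parameters
-- of H turn this into: F(u) = 0 forces s(u) ≥ 2, F(u) = 1 forces s(u) ≥ a, and F(u) ≥ 2 forces
-- F(u) − 2 + s(u) ≥ b, with (a,b) = (1,0), (2,0), (2,1), (2,2) in the four cases; in case (iv)
-- a fibre of weight 3 without help would give γ(H) = γ_I(H) = 3. A vertex with F(u) ≥ 3 can
-- be lowered to 2 once its deficit is moved to a neighbour, so F normalises to a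
-- (2,a,b)-dominating function of G of no larger weight. Conversely, a (2,a,b)-dominating
-- function g of G lifts by placing on the fibre of u a fixed pattern of weight g(u): for weight 1
-- a dominating vertex in case (i) and any vertex otherwise, for weight 2 a doubled dominating
-- vertex, a minimum 2-dominating set, a minimum dominating set or any doubled vertex.

module Submission where

open import Defs
open import Algebra.Properties.CommutativeSemigroup using (interchange)
open import Data.Bool using (Bool; true; false; if_then_else_; _∨_; _∧_)
open import Data.Empty using (⊥-elim)
open import Data.Fin as F using (Fin; toℕ; fromℕ<; combine; remQuot; _↑ˡ_; _↑ʳ_)
import Data.Fin.Properties as FP
open import Data.Nat using (ℕ; zero; suc; _+_; _*_; _∸_; _≤_; _<_; z≤n; s≤s; _≤?_)
open import Data.Nat.Properties
open import Data.Product using (Σ; _×_; _,_; proj₁; proj₂; ∃)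
open import Data.Sum using (_⊎_; inj₁; inj₂; [_,_]′)
open import Data.Vec using (Vec; _∷_; []; lookup)
open import Function using (_∘_; case_of_)
open import Function.Bundles using (_⇔_; mk⇔)
open import Relation.Binary.PropositionalEquality
  using (_≡_; _≢_; refl; cong; cong₂; trans; subst; module ≡-Reasoning) renaming (sym to ≡-sym)
open import Relation.Nullary using (yes; no)
open import Relation.Nullary.Decidable using (⌊_⌋; isYes≗does; dec-true; dec-false)

⌊≟⌋-refl : ∀ {m} (i : Fin m) → ⌊ i FP.≟ i ⌋ ≡ true
⌊≟⌋-refl i = trans (isYes≗does (i FP.≟ i)) (dec-true (i FP.≟ i) refl)

⌊≟⌋-≢ : ∀ {m} {i j : Fin m} → i ≢ j → ⌊ i FP.≟ j ⌋ ≡ false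
⌊≟⌋-≢ {i = i} {j} i≢j = trans (isYes≗does (i FP.≟ j)) (dec-false (i FP.≟ j) i≢j)

m≤n∧n+o≤m⇒o≡0 : ∀ {m n o} → m ≤ n → n + o ≤ m → o ≡ 0
m≤n∧n+o≤m⇒o≡0 {m} {n} {o} m≤n n+o≤m =
  n≤0⇒n≡0 (+-cancelˡ-≤ m o 0
    (≤-trans (+-monoˡ-≤ o m≤n) (≤-trans n+o≤m (≤-reflexive (≡-sym (+-identityʳ m))))))

sumFin-cong : ∀ m {f g : Fin m → ℕ} → (∀ i → f i ≡ g i) → sumFin m f ≡ sumFin m g
sumFin-cong zero    f≗g = refl
sumFin-cong (suc m) f≗g = cong₂ _+_ (f≗g F.zero) (sumFin-cong m (λ i → f≗g (F.suc i)))

sumFin-mono : ∀ m {f g : Fin m → ℕ} → (∀ i → f i ≤ g i) → sumFin m f ≤ sumFin m g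
sumFin-mono zero    f≤g = z≤n
sumFin-mono (suc m) f≤g = +-mono-≤ (f≤g F.zero) (sumFin-mono m (λ i → f≤g (F.suc i)))

sumFin-+ : ∀ m (f g : Fin m → ℕ) → sumFin m (λ i → f i + g i) ≡ sumFin m f + sumFin m g
sumFin-+ zero    f g = refl
sumFin-+ (suc m) f g =
  trans (cong (f F.zero + g F.zero +_) (sumFin-+ m _ _))
        (interchange +-commutativeSemigroup (f F.zero) (g F.zero) _ _)

sumFin-zero : ∀ m {f : Fin m → ℕ} → (∀ i → f i ≡ 0) → sumFin m f ≡ 0
sumFin-zero zero    f≗0 = refl
sumFin-zero (suc m) f≗0 = cong₂ _+_ (f≗0 F.zero) (sumFin-zero m (λ i → f≗0 (F.suc i)))

sumFin-concentrated : ∀ m (f : Fin m → ℕ) i → (∀ j → j ≢ i → f j ≡ 0) → sumFin m f ≡ f i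
sumFin-concentrated (suc m) f F.zero f≗0 =
  trans (cong (f F.zero +_) (sumFin-zero m (λ j → f≗0 (F.suc j) (λ ())))) (+-identityʳ _)
sumFin-concentrated (suc m) f (F.suc i) f≗0 =
  cong₂ _+_ (f≗0 F.zero (λ ()))
    (sumFin-concentrated m (λ j → f (F.suc j)) i (λ j j≢i → f≗0 (F.suc j) (j≢i ∘ FP.suc-injective)))

term≤sumFin : ∀ m (f : Fin m → ℕ) i → f i ≤ sumFin m f
term≤sumFin (suc m) f F.zero    = m≤m+n _ _
term≤sumFin (suc m) f (F.suc i) = ≤-trans (term≤sumFin m _ i) (m≤n+m _ _)

sumFin-↑ : ∀ m k (f : Fin (m + k) → ℕ) →
  sumFin (m + k) f ≡ sumFin m (λ i → f (i ↑ˡ k)) + sumFin k (λ j → f (m ↑ʳ j))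
sumFin-↑ zero    k f = refl
sumFin-↑ (suc m) k f =
  trans (cong (f F.zero +_) (sumFin-↑ m k (λ i → f (F.suc i)))) (≡-sym (+-assoc (f F.zero) _ _))

sumFin-combine : ∀ m k (f : Fin (m * k) → ℕ) →
  sumFin (m * k) f ≡ sumFin m (λ i → sumFin k (λ j → f (combine i j)))
sumFin-combine zero    k f = refl
sumFin-combine (suc m) k f =
  trans (sumFin-↑ k (m * k) f)
        (cong (sumFin k (λ j → f (j ↑ˡ (m * k))) +_) (sumFin-combine m k (λ j → f (k ↑ʳ j))))

sumFin-mono-tight : ∀ m (f g : Fin m → ℕ) → (∀ i → f i ≤ g i) → sumFin m g ≤ sumFin m f →
  ∀ i → f i ≡ g i
sumFin-mono-tight (suc m) f g f≤g Σg≤Σf F.zero =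
  ≤-antisym (f≤g F.zero) (+-cancelʳ-≤ (sumFin m (λ i → g (F.suc i))) _ _
    (≤-trans Σg≤Σf (+-monoʳ-≤ (f F.zero) (sumFin-mono m (λ i → f≤g (F.suc i))))))
sumFin-mono-tight (suc m) f g f≤g Σg≤Σf (F.suc i) =
  sumFin-mono-tight m _ _ (λ j → f≤g (F.suc j))
    (+-cancelˡ-≤ (g F.zero) _ _ (≤-trans Σg≤Σf (+-monoˡ-≤ _ (f≤g F.zero)))) i

sumFin≤1⇒∃≡0 : ∀ m → 2 ≤ m → (f : Fin m → ℕ) → sumFin m f ≤ 1 → ∃ λ i → f i ≡ 0
sumFin≤1⇒∃≡0 (suc zero) (s≤s ()) f Σf≤1
sumFin≤1⇒∃≡0 (suc (suc m)) _ f Σf≤1 with first-or-second (f F.zero) (f (F.suc F.zero)) _ Σf≤1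
  where
  first-or-second : ∀ x y r → x + (y + r) ≤ 1 → x ≡ 0 ⊎ y ≡ 0
  first-or-second zero    y       r _ = inj₁ refl
  first-or-second (suc x) zero    r _ = inj₂ refl
  first-or-second (suc x) (suc y) r (s≤s le) with ≤-trans (m≤n+m (suc y + r) x) le
  ... | ()
... | inj₁ f₀≡0 = F.zero , f₀≡0
... | inj₂ f₁≡0 = F.suc F.zero , f₁≡0

sumFin-*ˡ : ∀ m c (f : Fin m → ℕ) → sumFin m (λ i → c * f i) ≡ c * sumFin m f
sumFin-*ˡ zero    c f = ≡-sym (*-zeroʳ c)
sumFin-*ˡ (suc m) c f =
  trans (cong (c * f F.zero +_) (sumFin-*ˡ m c _)) (≡-sym (*-distribˡ-+ c (f F.zero) _))

positive : ℕ → Bool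
positive zero    = false
positive (suc _) = true

ind-positive≤ : ∀ k → ind (positive k) ≤ k
ind-positive≤ zero    = z≤n
ind-positive≤ (suc k) = s≤s z≤n

positive≡false⇒≡0 : ∀ k → positive k ≡ false → k ≡ 0
positive≡false⇒≡0 zero _ = refl

1≤sumFin⇒1≤count-positive : ∀ m (f : Fin m → ℕ) → 1 ≤ sumFin m f →
  1 ≤ sumFin m (λ i → ind (positive (f i)))
1≤sumFin⇒1≤count-positive (suc m) f 1≤Σf with f F.zero
... | suc _ = s≤s z≤n
... | zero  = 1≤sumFin⇒1≤count-positive m _ 1≤Σf

single : ∀ {m} → Fin m → ℕ → Fin m → ℕ
single i d j = if ⌊ j FP.≟ i ⌋ then d else 0

single-self : ∀ {m} (i : Fin m) d → single i d i ≡ d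
single-self i d = cong (λ c → if c then d else 0) (⌊≟⌋-refl i)

single-other : ∀ {m} (i j : Fin m) d → j ≢ i → single i d j ≡ 0
single-other i j d j≢i = cong (λ c → if c then d else 0) (⌊≟⌋-≢ j≢i)

sumFin-single : ∀ {m} (i : Fin m) d → sumFin m (single i d) ≡ d
sumFin-single {m} i d = trans (sumFin-concentrated m _ i (λ j → single-other i j d)) (single-self i d)

module _ (G : Graph) where

  nbSum-cong : {p q : Fin (n G) → ℕ} → (∀ i → p i ≡ q i) → ∀ v → nbSum G p v ≡ nbSum G q v
  nbSum-cong p≗q v = sumFin-cong (n G) λ u → cong (λ x → if adj G v u then x else 0) (p≗q u)

  nbSum-*ˡ : ∀ c (p : Fin (n G) → ℕ) v → nbSum G (λ y → c * p y) v ≡ c * nbSum G p v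
  nbSum-*ˡ c p v = trans (sumFin-cong (n G) (λ u → gate (adj G v u))) (sumFin-*ˡ (n G) c _)
    where
    gate : ∀ b {x} → (if b then c * x else 0) ≡ c * (if b then x else 0)
    gate true  = refl
    gate false = ≡-sym (*-zeroʳ c)

  nbSum≤sumFin : ∀ (p : Fin (n G) → ℕ) v → nbSum G p v ≤ sumFin (n G) p
  nbSum≤sumFin p v = sumFin-mono (n G) λ u → gate (adj G v u)
    where
    gate : ∀ c {x} → (if c then x else 0) ≤ x
    gate true  = ≤-refl
    gate false = z≤n

  term≤nbSum : ∀ (p : Fin (n G) → ℕ) v u → adj G v u ≡ true → p u ≤ nbSum G p v
  term≤nbSum p v u vu = subst (λ c → (if c then p u else 0) ≤ nbSum G p v) vu (term≤sumFin (n G) _ u)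

-- Lexicographic product

module _ (G H : Graph) where

  fibreSum : (Fin (n G * n H) → ℕ) → Fin (n G) → ℕ
  fibreSum f u = sumFin (n H) (λ y → f (combine u y))

  sumFin-∘L : ∀ (f : Fin (n G * n H) → ℕ) → sumFin (n G * n H) f ≡ sumFin (n G) (fibreSum f)
  sumFin-∘L = sumFin-combine (n G) (n H)

  adj-∘L : ∀ u v x y →
    adj (G ∘L H) (combine u v) (combine x y) ≡ (adj G u x ∨ (⌊ u FP.≟ x ⌋ ∧ adj H v y))
  adj-∘L u v x y =
    cong₂ (pairAdj G H) (FP.remQuot-combine {n G} {n H} u v) (FP.remQuot-combine {n G} {n H} x y)

  private
    fibreContribution : ∀ (f : Fin (n G * n H) → ℕ) u v x →
      sumFin (n H) (λ y → if adj G u x ∨ (⌊ u FP.≟ x ⌋ ∧ adj H v y) then f (combine x y) else 0)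
      ≡ (if adj G u x then fibreSum f x else 0) + (if ⌊ u FP.≟ x ⌋ then nbSum H (f ∘ combine u) v else 0)
    fibreContribution f u v x with adj G u x in ux | u FP.≟ x
    ... | true  | yes refl with () ← trans (≡-sym ux) (irrefl G u)
    ... | true  | no _     = ≡-sym (+-identityʳ _)
    ... | false | yes refl = refl
    ... | false | no _     = sumFin-zero (n H) (λ _ → refl)

  nbSum-∘L : ∀ (f : Fin (n G * n H) → ℕ) u v →
    nbSum (G ∘L H) f (combine u v) ≡ nbSum G (fibreSum f) u + nbSum H (f ∘ combine u) v
  nbSum-∘L f u v = begin
    nbSum (G ∘L H) f (combine u v)
      ≡⟨ sumFin-combine (n G) (n H) _ ⟩
    sumFin (n G) (λ x → sumFin (n H) (λ y →
      if adj (G ∘L H) (combine u v) (combine x y) then f (combine x y) else 0))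
      ≡⟨ sumFin-cong (n G) (λ x → sumFin-cong (n H) (λ y →
           cong (λ c → if c then f (combine x y) else 0) (adj-∘L u v x y))) ⟩
    sumFin (n G) (λ x → sumFin (n H) (λ y →
      if adj G u x ∨ (⌊ u FP.≟ x ⌋ ∧ adj H v y) then f (combine x y) else 0))
      ≡⟨ sumFin-cong (n G) (fibreContribution f u v) ⟩
    sumFin (n G) (λ x → (if adj G u x then fibreSum f x else 0) + (if ⌊ u FP.≟ x ⌋ then nbH else 0))
      ≡⟨ sumFin-+ (n G) _ _ ⟩
    nbSum G (fibreSum f) u + sumFin (n G) (λ x → if ⌊ u FP.≟ x ⌋ then nbH else 0)
      ≡⟨ cong (nbSum G (fibreSum f) u +_) (trans
           (sumFin-concentrated (n G) _ u (λ x x≢u → cong (λ c → if c then nbH else 0) (⌊≟⌋-≢ (x≢u ∘ ≡-sym))))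
           (cong (λ c → if c then nbH else 0) (⌊≟⌋-refl u))) ⟩
    nbSum G (fibreSum f) u + nbH ∎
    where
    open ≡-Reasoning
    nbH = nbSum H (f ∘ combine u) v

IsMin-transfer : {A B : Set} (P : A → Set) (sA : A → ℕ) (Q : B → Set) (sB : B → ℕ) →
  (∀ x → P x → Σ B λ y → Q y × sB y ≤ sA x) →
  (∀ y → Q y → Σ A λ x → P x × sA x ≤ sB y) →
  ∀ {k} → IsMin P sA k → IsMin Q sB k
IsMin-transfer P sA Q sB P⇒Q Q⇒P {k} ((x , px , sx≡k) , k≤P) with P⇒Q x px
... | y , qy , sy≤sx = (y , qy , ≤-antisym (subst (sB y ≤_) sx≡k sy≤sx) (k≤Q y qy)) , k≤Q
  where
  k≤Q : ∀ y → Q y → k ≤ sB y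
  k≤Q y qy with Q⇒P y qy
  ... | x' , px' , sx'≤sy = ≤-trans (k≤P x' px') sx'≤sy

IsMin-⇔ : {A B : Set} (P : A → Set) (sA : A → ℕ) (Q : B → Set) (sB : B → ℕ) →
  (∀ x → P x → Σ B λ y → Q y × sB y ≤ sA x) →
  (∀ y → Q y → Σ A λ x → P x × sA x ≤ sB y) →
  ∀ k → IsMin P sA k ⇔ IsMin Q sB k
IsMin-⇔ P sA Q sB P⇒Q Q⇒P k =
  mk⇔ (IsMin-transfer P sA Q sB P⇒Q Q⇒P) (IsMin-transfer Q sB P sA Q⇒P P⇒Q)

WDomWithin : (G : Graph) {l : ℕ} → Vec ℕ (suc l) → ℕ → Set
WDomWithin G {l} w m = Σ (Fin (n G) → Fin (suc l)) λ g → IsWDom G w g × weight G g ≤ m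

WDomWithin-mono : ∀ (G : Graph) {l} (w : Vec ℕ (suc l)) {m m'} →
  m ≤ m' → WDomWithin G w m → WDomWithin G w m'
WDomWithin-mono G w m≤m' (g , g-dom , g≤m) = g , g-dom , ≤-trans g≤m m≤m'

-- Relaxed domination on G

-- The (2,a,b) condition extended to all values k ∈ ℕ: the surplus of k over 2
-- counts towards the threshold b.
Admissible : ℕ → ℕ → ℕ → ℕ → Set
Admissible a b zero          s = 2 ≤ s
Admissible a b (suc zero)    s = a ≤ s
Admissible a b (suc (suc k)) s = b ≤ k + s

RelaxedDom : (G : Graph) → ℕ → ℕ → (Fin (n G) → ℕ) → Set
RelaxedDom G a b h = ∀ u → Admissible a b (h u) (nbSum G h u)

Admissible-mono : ∀ {a b} k {s t} → s ≤ t → Admissible a b k s → Admissible a b k t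
Admissible-mono zero          s≤t ok = ≤-trans ok s≤t
Admissible-mono (suc zero)    s≤t ok = ≤-trans ok s≤t
Admissible-mono (suc (suc k)) s≤t ok = ≤-trans ok (+-monoʳ-≤ k s≤t)

module _ {a b : ℕ} (a≤2 : a ≤ 2) (b≤2 : b ≤ 2) where

  2≤⇒Admissible : ∀ k {s} → 2 ≤ s → Admissible a b k s
  2≤⇒Admissible zero          2≤s = 2≤s
  2≤⇒Admissible (suc zero)    2≤s = ≤-trans a≤2 2≤s
  2≤⇒Admissible (suc (suc k)) 2≤s = ≤-trans b≤2 (≤-trans 2≤s (m≤n+m _ k))

Admissible⇒lookup : ∀ {a b} (i : Fin 3) {s} → Admissible a b (toℕ i) s →
  lookup (2 ∷ a ∷ b ∷ []) i ≤ s
Admissible⇒lookup F.zero                 ok = ok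
Admissible⇒lookup (F.suc F.zero)         ok = ok
Admissible⇒lookup (F.suc (F.suc F.zero)) ok = ok

Admissible⇒deficit≤surplus : ∀ {a b} k {s} → 2 ≤ k → Admissible a b k s → b ∸ s ≤ k ∸ 2
Admissible⇒deficit≤surplus (suc zero) (s≤s ()) _
Admissible⇒deficit≤surplus (suc (suc k)) {s} _ ok =
  ≤-trans (∸-monoˡ-≤ s ok) (≤-reflexive (m+n∸n≡m k s))

data Position {m} (u x y : Fin m) : Set where
  at-u      : y ≡ u → Position u x y
  at-x      : y ≡ x → Position u x y
  elsewhere : y ≢ u → y ≢ x → Position u x y

position : ∀ {m} (u x y : Fin m) → Position u x y
position u x y with y FP.≟ u | y FP.≟ x
... | yes y≡u | _       = at-u y≡u
... | no y≢u  | yes y≡x = at-x y≡x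
... | no y≢u  | no y≢x  = elsewhere y≢u y≢x

module Normalization (G : Graph) (noIso : NoIsolated G) {a b : ℕ} (a≤2 : a ≤ 2) (b≤2 : b ≤ 2) where

  surplus : (Fin (n G) → ℕ) → ℕ
  surplus h = sumFin (n G) (λ y → h y ∸ 2)

  bounded⇒wDom : ∀ h → RelaxedDom G a b h → (∀ u → h u ≤ 2) →
    WDomWithin G (2 ∷ a ∷ b ∷ []) (sumFin (n G) h)
  bounded⇒wDom h relaxed h≤2 = g , g-dom , ≤-reflexive (sumFin-cong (n G) g≗h)
    where
    g : Fin (n G) → Fin 3
    g u = fromℕ< (s≤s (h≤2 u))
    g≗h : ∀ u → toℕ (g u) ≡ h u
    g≗h u = FP.toℕ-fromℕ< (s≤s (h≤2 u))
    g-dom : IsWDom G (2 ∷ a ∷ b ∷ []) g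
    g-dom v = subst (lookup (2 ∷ a ∷ b ∷ []) (g v) ≤_) (≡-sym (nbSum-cong G g≗h v))
      (Admissible⇒lookup (g v) (subst (λ k → Admissible a b k (nbSum G h v)) (≡-sym (g≗h v)) (relaxed v)))

  -- Lowering h u ≥ 3 to 2 can only break the condition at u, whose deficit b ∸ s is
  -- moved onto a neighbour x; every neighbour of u then sees the 2 at u and is satisfied.
  module Lower (h : Fin (n G) → ℕ) (relaxed : RelaxedDom G a b h) (u : Fin (n G)) (3≤hu : 3 ≤ h u) where
    x : Fin (n G)
    x = proj₁ (noIso u)
    ux : adj G u x ≡ true
    ux = proj₂ (noIso u)
    xu : adj G x u ≡ true
    xu = trans (sym G x u) ux
    u≢x : u ≢ x
    u≢x u≡x with () ← trans (≡-sym ux) (trans (cong (adj G u) (≡-sym u≡x)) (irrefl G u))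
    x≢u : x ≢ u
    x≢u = u≢x ∘ ≡-sym

    s = nbSum G h u
    d = b ∸ s

    lowered : Fin (n G) → ℕ
    lowered y = (if ⌊ y FP.≟ u ⌋ then 2 else h y) + single x d y

    lowered-u : lowered u ≡ 2
    lowered-u = cong₂ _+_ (cong (λ c → if c then 2 else h u) (⌊≟⌋-refl u)) (single-other x u d u≢x)

    lowered-x : lowered x ≡ h x + d
    lowered-x = cong₂ _+_ (cong (λ c → if c then 2 else h x) (⌊≟⌋-≢ x≢u)) (single-self x d)

    lowered-elsewhere : ∀ y → y ≢ u → y ≢ x → lowered y ≡ h y
    lowered-elsewhere y y≢u y≢x =
      trans (cong₂ _+_ (cong (λ c → if c then 2 else h y) (⌊≟⌋-≢ y≢u)) (single-other x y d y≢x))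
            (+-identityʳ _)

    ≤-lowered : ∀ y → y ≢ u → h y ≤ lowered y
    ≤-lowered y y≢u with position u x y
    ... | at-u y≡u          = ⊥-elim (y≢u y≡u)
    ... | at-x refl         = subst (h y ≤_) (≡-sym lowered-x) (m≤m+n _ _)
    ... | elsewhere y≢u y≢x = ≤-reflexive (≡-sym (lowered-elsewhere y y≢u y≢x))

    s+d≤nbSum-u : s + d ≤ nbSum G lowered u
    s+d≤nbSum-u = subst (_≤ nbSum G lowered u) (trans (sumFin-+ (n G) _ _) (cong (s +_) (sumFin-single x d)))
      (sumFin-mono (n G) pointwise)
      where
      pointwise : ∀ z → (if adj G u z then h z else 0) + single x d z ≤ (if adj G u z then lowered z else 0)
      pointwise z with position u x z
      ... | at-u refl rewrite irrefl G u = ≤-reflexive (single-other x u d u≢x)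
      ... | at-x refl rewrite ux = ≤-reflexive (trans (cong (h x +_) (single-self x d)) (≡-sym lowered-x))
      ... | elsewhere z≢u z≢x with adj G u z
      ...   | true  = ≤-trans (≤-reflexive (trans (cong (h z +_) (single-other x z d z≢x)) (+-identityʳ _)))
                              (≤-lowered z z≢u)
      ...   | false = ≤-reflexive (single-other x z d z≢x)

    nbSum-lowered-nonadjacent : ∀ y → adj G y u ≡ false → nbSum G h y ≤ nbSum G lowered y
    nbSum-lowered-nonadjacent y yu = sumFin-mono (n G) pointwise
      where
      pointwise : ∀ z → (if adj G y z then h z else 0) ≤ (if adj G y z then lowered z else 0)
      pointwise z with adj G y z in yz
      ... | false = z≤n
      ... | true  = ≤-lowered z (λ { refl → case trans (≡-sym yz) yu of λ () })

    lowered-relaxed : RelaxedDom G a b lowered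
    lowered-relaxed y with position u x y
    ... | at-u refl = subst (λ k → Admissible a b k (nbSum G lowered u)) (≡-sym lowered-u)
                        (≤-trans (m≤n+m∸n b s) s+d≤nbSum-u)
    ... | at-x refl = 2≤⇒Admissible a≤2 b≤2 (lowered x)
                        (subst (_≤ nbSum G lowered x) lowered-u (term≤nbSum G lowered x u xu))
    ... | elsewhere y≢u y≢x with adj G y u in yu
    ...   | true  = 2≤⇒Admissible a≤2 b≤2 (lowered y)
                        (subst (_≤ nbSum G lowered y) lowered-u (term≤nbSum G lowered y u yu))
    ...   | false = subst (λ k → Admissible a b k (nbSum G lowered y)) (≡-sym (lowered-elsewhere y y≢u y≢x))
                      (Admissible-mono (h y) (nbSum-lowered-nonadjacent y yu) (relaxed y))

    sumFin-lowered≤ : sumFin (n G) lowered ≤ sumFin (n G) h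
    sumFin-lowered≤ = +-cancelʳ-≤ (h u ∸ 2) _ _ (begin
      sumFin (n G) lowered + (h u ∸ 2)
        ≡⟨ cong (sumFin (n G) lowered +_) (≡-sym (sumFin-single u (h u ∸ 2))) ⟩
      sumFin (n G) lowered + sumFin (n G) (single u (h u ∸ 2))
        ≡⟨ ≡-sym (sumFin-+ (n G) _ _) ⟩
      sumFin (n G) (λ y → lowered y + single u (h u ∸ 2) y)
        ≤⟨ sumFin-mono (n G) pointwise ⟩
      sumFin (n G) (λ y → h y + single x d y)
        ≡⟨ trans (sumFin-+ (n G) _ _) (cong (sumFin (n G) h +_) (sumFin-single x d)) ⟩
      sumFin (n G) h + d
        ≤⟨ +-monoʳ-≤ (sumFin (n G) h)
             (Admissible⇒deficit≤surplus (h u) (≤-trans (n≤1+n 2) 3≤hu) (relaxed u)) ⟩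
      sumFin (n G) h + (h u ∸ 2) ∎)
      where
      open ≤-Reasoning
      pointwise : ∀ y → lowered y + single u (h u ∸ 2) y ≤ h y + single x d y
      pointwise y with position u x y
      ... | at-u refl rewrite lowered-u | single-self u (h u ∸ 2) | single-other x u d u≢x | +-identityʳ (h u) =
              ≤-reflexive (m+[n∸m]≡n (≤-trans (n≤1+n 2) 3≤hu))
      ... | at-x refl rewrite lowered-x | single-self x d | single-other u x (h u ∸ 2) x≢u =
              ≤-reflexive (+-identityʳ _)
      ... | elsewhere y≢u y≢x
              rewrite lowered-elsewhere y y≢u y≢x | single-other x y d y≢x | single-other u y (h u ∸ 2) y≢u =
                ≤-refl

    surplus-lowered< : surplus lowered < surplus h
    surplus-lowered< = subst (_≤ surplus h)
      (trans (sumFin-+ (n G) _ _) (trans (cong (surplus lowered +_) (sumFin-single u 1)) (+-comm _ 1)))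
      (sumFin-mono (n G) pointwise)
      where
      pointwise : ∀ y → (lowered y ∸ 2) + single u 1 y ≤ h y ∸ 2
      pointwise y with position u x y
      ... | at-u refl rewrite lowered-u | single-self u 1 = ∸-monoˡ-≤ 2 3≤hu
      -- A positive deficit keeps x at most 2: h x + d ≤ s + (b ∸ s) = b ≤ 2.
      ... | at-x refl rewrite lowered-x | single-other u x 1 x≢u | +-identityʳ (h x + d ∸ 2) with b ≤? s
      ...   | yes b≤s rewrite m≤n⇒m∸n≡0 b≤s | +-identityʳ (h x) = ≤-refl
      ...   | no b≰s = ≤-trans (≤-reflexive (m≤n⇒m∸n≡0 hx+d≤2)) z≤n
        where
        hx+d≤2 : h x + d ≤ 2
        hx+d≤2 = ≤-trans (+-monoˡ-≤ d (term≤nbSum G h u x ux))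
                   (≤-trans (≤-reflexive (m+[n∸m]≡n (<⇒≤ (≰⇒> b≰s)))) b≤2)
      pointwise y | elsewhere y≢u y≢x
        rewrite lowered-elsewhere y y≢u y≢x | single-other u y 1 y≢u = ≤-reflexive (+-identityʳ _)

  normalize : ∀ fuel h → surplus h ≤ fuel → RelaxedDom G a b h →
    WDomWithin G (2 ∷ a ∷ b ∷ []) (sumFin (n G) h)
  normalize fuel h surplus≤fuel relaxed with FP.any? (λ u → 3 ≤? h u)
  ... | no none = bounded⇒wDom h relaxed (λ u → ≤-pred (≰⇒> (λ 3≤hu → none (u , 3≤hu))))
  ... | yes (u , 3≤hu) with fuel
  ...   | zero = ⊥-elim (1+n≰n (≤-trans (∸-monoˡ-≤ 2 3≤hu)
                     (≤-trans (term≤sumFin (n G) (λ y → h y ∸ 2) u) surplus≤fuel)))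
  ...   | suc fuel' = WDomWithin-mono G (2 ∷ a ∷ b ∷ []) sumFin-lowered≤
                        (normalize fuel' lowered (≤-pred (≤-trans surplus-lowered< surplus≤fuel)) lowered-relaxed)
    where open Lower h relaxed u 3≤hu

  relaxedDom⇒wDom : ∀ h → RelaxedDom G a b h → WDomWithin G (2 ∷ a ∷ b ∷ []) (sumFin (n G) h)
  relaxedDom⇒wDom h = normalize (surplus h) h ≤-refl

-- Fibres in H

-- The Italian condition on one fibre of G ∘ H, where s is the weight on the G-neighbouring
-- fibres, every vertex of which is adjacent to the whole fibre.
ItalianWith : (H : Graph) → ℕ → (Fin (n H) → Fin 3) → Set
ItalianWith H s q = ∀ v → toℕ (q v) ≡ 0 → 2 ≤ s + nbSum H (toℕ ∘ q) v

FibrePattern : (H : Graph) → ℕ → ℕ → Set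
FibrePattern H k s = Σ (Fin (n H) → Fin 3) λ q → weight H q ≡ k × ItalianWith H s q

toℕ≡0⇒≡zero : ∀ {m} (i : Fin (suc m)) → toℕ i ≡ 0 → i ≡ F.zero
toℕ≡0⇒≡zero F.zero _ = refl

module _ (K : Graph) where

  ItalianWith0⇒WDom : ∀ {q} → ItalianWith K 0 q → IsWDom K (2 ∷ 0 ∷ 0 ∷ []) q
  ItalianWith0⇒WDom {q} italian v with q v in qv
  ... | F.zero               = italian v (cong toℕ qv)
  ... | F.suc F.zero         = z≤n
  ... | F.suc (F.suc F.zero) = z≤n

  WDom⇒ItalianWith0 : ∀ {q} → IsWDom K (2 ∷ 0 ∷ 0 ∷ []) q → ItalianWith K 0 q
  WDom⇒ItalianWith0 {q} q-dom v qv≡0 =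
    subst (λ j → lookup (2 ∷ 0 ∷ 0 ∷ []) j ≤ nbSum K (toℕ ∘ q) v) (toℕ≡0⇒≡zero _ qv≡0) (q-dom v)

module Transfer (G H : Graph) (noIso : NoIsolated G) {a b : ℕ} (a≤2 : a ≤ 2) (b≤2 : b ≤ 2)
  (admissible : ∀ q s → ItalianWith H s q → Admissible a b (weight H q) s)
  (pattern₁ : FibrePattern H 1 a) (pattern₂ : FibrePattern H 2 b)
  where

  italian⇒wDom : ∀ f → IsWDom (G ∘L H) (2 ∷ 0 ∷ 0 ∷ []) f →
    WDomWithin G (2 ∷ a ∷ b ∷ []) (weight (G ∘L H) f)
  italian⇒wDom f f-dom =
    WDomWithin-mono G (2 ∷ a ∷ b ∷ []) (≤-reflexive (≡-sym (sumFin-∘L G H (toℕ ∘ f))))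
      (Normalization.relaxedDom⇒wDom G noIso a≤2 b≤2 F F-relaxed)
    where
    F : Fin (n G) → ℕ
    F = fibreSum G H (toℕ ∘ f)
    F-relaxed : RelaxedDom G a b F
    F-relaxed u = admissible (f ∘ combine u) (nbSum G F u) λ v fuv≡0 →
      subst (2 ≤_) (nbSum-∘L G H (toℕ ∘ f) u v) (WDom⇒ItalianWith0 (G ∘L H) f-dom (combine u v) fuv≡0)

  fibre : Fin 3 → Fin (n H) → Fin 3
  fibre F.zero                 = λ _ → F.zero
  fibre (F.suc F.zero)         = proj₁ pattern₁
  fibre (F.suc (F.suc F.zero)) = proj₁ pattern₂

  weight-fibre : ∀ k → weight H (fibre k) ≡ toℕ k
  weight-fibre F.zero                 = sumFin-zero (n H) (λ _ → refl)
  weight-fibre (F.suc F.zero)         = proj₁ (proj₂ pattern₁)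
  weight-fibre (F.suc (F.suc F.zero)) = proj₁ (proj₂ pattern₂)

  fibre-italian : ∀ k → ItalianWith H (lookup (2 ∷ a ∷ b ∷ []) k) (fibre k)
  fibre-italian F.zero v _               = m≤m+n 2 _
  fibre-italian (F.suc F.zero)         = proj₂ (proj₂ pattern₁)
  fibre-italian (F.suc (F.suc F.zero)) = proj₂ (proj₂ pattern₂)

  wDom⇒italian : ∀ g → IsWDom G (2 ∷ a ∷ b ∷ []) g →
    WDomWithin (G ∘L H) (2 ∷ 0 ∷ 0 ∷ []) (weight G g)
  wDom⇒italian g g-dom = f , f-dom , ≤-reflexive weight-f
    where
    f : Fin (n G * n H) → Fin 3
    f i = fibre (g (proj₁ (remQuot {n G} (n H) i))) (proj₂ (remQuot {n G} (n H) i))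
    f-combine : ∀ u v → f (combine u v) ≡ fibre (g u) v
    f-combine u v = cong (λ p → fibre (g (proj₁ p)) (proj₂ p)) (FP.remQuot-combine {n G} {n H} u v)
    fibreSum-f : ∀ u → fibreSum G H (toℕ ∘ f) u ≡ toℕ (g u)
    fibreSum-f u = trans (sumFin-cong (n H) (λ y → cong toℕ (f-combine u y))) (weight-fibre (g u))
    weight-f : weight (G ∘L H) f ≡ weight G g
    weight-f = trans (sumFin-∘L G H (toℕ ∘ f)) (sumFin-cong (n G) fibreSum-f)
    f-italian-combine : ∀ u v → toℕ (f (combine u v)) ≡ 0 → 2 ≤ nbSum (G ∘L H) (toℕ ∘ f) (combine u v)
    f-italian-combine u v fuv≡0 = begin
      2
        ≤⟨ fibre-italian (g u) v (trans (cong toℕ (≡-sym (f-combine u v))) fuv≡0) ⟩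
      lookup (2 ∷ a ∷ b ∷ []) (g u) + nbSum H (toℕ ∘ fibre (g u)) v
        ≤⟨ +-monoˡ-≤ _ (g-dom u) ⟩
      nbSum G (toℕ ∘ g) u + nbSum H (toℕ ∘ fibre (g u)) v
        ≡⟨ cong₂ _+_ (≡-sym (nbSum-cong G fibreSum-f u))
                     (nbSum-cong H (λ y → cong toℕ (≡-sym (f-combine u y))) v) ⟩
      nbSum G (fibreSum G H (toℕ ∘ f)) u + nbSum H (toℕ ∘ f ∘ combine u) v
        ≡⟨ ≡-sym (nbSum-∘L G H (toℕ ∘ f) u v) ⟩
      nbSum (G ∘L H) (toℕ ∘ f) (combine u v) ∎
      where open ≤-Reasoning
    f-dom : IsWDom (G ∘L H) (2 ∷ 0 ∷ 0 ∷ []) f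
    f-dom = ItalianWith0⇒WDom (G ∘L H) λ i →
      subst (λ j → toℕ (f j) ≡ 0 → 2 ≤ nbSum (G ∘L H) (toℕ ∘ f) j) (FP.combine-remQuot {n G} (n H) i)
        (f-italian-combine (proj₁ (remQuot {n G} (n H) i)) (proj₂ (remQuot {n G} (n H) i)))

  γI-∘L⇔γw : ∀ k → GammaI (G ∘L H) k ⇔ GammaW G (2 ∷ a ∷ b ∷ []) k
  γI-∘L⇔γw = IsMin-⇔ _ _ _ _ italian⇒wDom wDom⇒italian

module _ (H : Graph) where

  support : (Fin (n H) → ℕ) → Fin (n H) → Bool
  support p v = positive (p v)

  setSize-support≤ : ∀ p → setSize H (support p) ≤ sumFin (n H) p
  setSize-support≤ p = sumFin-mono (n H) (λ v → ind-positive≤ (p v))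

  support-dominating : ∀ p → (∀ v → p v ≡ 0 → 1 ≤ nbSum H p v) → IsKDomSet 1 H (support p)
  support-dominating p dominating v v∉S =
    subst (1 ≤_) (sumFin-cong (n H) (λ u → gate (adj H v u)))
      (1≤sumFin⇒1≤count-positive (n H) _ (dominating v (positive≡false⇒≡0 _ v∉S)))
    where
    gate : ∀ c {x} → ind (positive (if c then x else 0)) ≡ (if c then ind (positive x) else 0)
    gate true  = refl
    gate false = refl

  italianWith≤1⇒dominating : ∀ {s q} → ItalianWith H s q → s ≤ 1 →
    ∀ v → toℕ (q v) ≡ 0 → 1 ≤ nbSum H (toℕ ∘ q) v
  italianWith≤1⇒dominating italian s≤1 v qv≡0 =
    +-cancelˡ-≤ 1 1 _ (≤-trans (italian v qv≡0) (+-monoˡ-≤ _ s≤1))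

  γ≤weight : ∀ {g s q} → Gamma H g → ItalianWith H s q → s ≤ 1 → g ≤ weight H q
  γ≤weight {q = q} (_ , minimal) italian s≤1 =
    ≤-trans (minimal _ (support-dominating (toℕ ∘ q) (italianWith≤1⇒dominating italian s≤1)))
            (setSize-support≤ (toℕ ∘ q))

  γ≤γI : ∀ {g gI} → Gamma H g → GammaI H gI → g ≤ gI
  γ≤γI γ ((q , q-dom , weight≡gI) , _) =
    ≤-trans (γ≤weight γ (WDom⇒ItalianWith0 H q-dom) z≤n) (≤-reflexive weight≡gI)

  γI≤weight : ∀ {gI q} → GammaI H gI → ItalianWith H 0 q → gI ≤ weight H q
  γI≤weight (_ , minimal) italian = minimal _ (ItalianWith0⇒WDom H italian)

  -- An Italian function of weight at most γ is the indicator of its support,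
  -- which is therefore 2-dominating.
  γ₂≤weight : ∀ {g g₂ q} → Gamma H g → Gamma2 H g₂ → ItalianWith H 0 q → weight H q ≤ g →
    g₂ ≤ weight H q
  γ₂≤weight {q = q} γ (_ , minimal₂) italian w≤g =
    ≤-trans (minimal₂ S S-2-dominating) (setSize-support≤ (toℕ ∘ q))
    where
    S = support (toℕ ∘ q)
    S-dominating : IsKDomSet 1 H S
    S-dominating = support-dominating (toℕ ∘ q) (italianWith≤1⇒dominating italian z≤n)
    S≗q : ∀ v → ind (S v) ≡ toℕ (q v)
    S≗q = sumFin-mono-tight (n H) (λ v → ind (S v)) (toℕ ∘ q) (λ v → ind-positive≤ (toℕ (q v)))
            (≤-trans w≤g (proj₂ γ S S-dominating))
    S-2-dominating : IsKDomSet 2 H S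
    S-2-dominating v v∉S =
      subst (2 ≤_) (nbSum-cong H (λ y → ≡-sym (S≗q y)) v)
        (italian v (trans (≡-sym (S≗q v)) (cong ind v∉S)))

  scaled : Fin 3 → (Fin (n H) → Bool) → Fin (n H) → Fin 3
  scaled d S y = if S y then d else F.zero

  toℕ-scaled : ∀ d S y → toℕ (scaled d S y) ≡ toℕ d * ind (S y)
  toℕ-scaled d S y with S y
  ... | true  = ≡-sym (*-identityʳ (toℕ d))
  ... | false = ≡-sym (*-zeroʳ (toℕ d))

  kDomSet⇒FibrePattern : ∀ {j S m} → IsKDomSet j H S → setSize H S ≡ m → (d : Fin 3) →
    FibrePattern H (toℕ d * m) (2 ∸ toℕ d * j)
  kDomSet⇒FibrePattern {j} {S} {m} S-dom size≡m d = scaled d S , weight-scaled , italian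
    where
    weight-scaled : weight H (scaled d S) ≡ toℕ d * m
    weight-scaled = trans (sumFin-cong (n H) (toℕ-scaled d S))
                      (trans (sumFin-*ˡ (n H) (toℕ d) _) (cong (toℕ d *_) size≡m))
    italian : ItalianWith H (2 ∸ toℕ d * j) (scaled d S)
    italian v dSv≡0 with S v in Sv
    ... | true  = subst (λ e → 2 ≤ 2 ∸ e * j + nbSum H (toℕ ∘ scaled d S) v) (≡-sym dSv≡0) (m≤m+n 2 _)
    ... | false = begin
      2                                         ≤⟨ m≤n+m∸n 2 dj ⟩
      dj + (2 ∸ dj)                             ≡⟨ +-comm dj _ ⟩
      (2 ∸ dj) + dj                             ≤⟨ +-monoʳ-≤ (2 ∸ dj) (*-monoʳ-≤ (toℕ d) (S-dom v Sv)) ⟩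
      (2 ∸ dj) + toℕ d * nbSum H (ind ∘ S) v    ≡⟨ cong (2 ∸ dj +_) (≡-sym nbSum-scaled) ⟩
      (2 ∸ dj) + nbSum H (toℕ ∘ scaled d S) v   ∎
      where
      open ≤-Reasoning
      dj = toℕ d * j
      nbSum-scaled : nbSum H (toℕ ∘ scaled d S) v ≡ toℕ d * nbSum H (ind ∘ S) v
      nbSum-scaled = trans (nbSum-cong H (toℕ-scaled d S) v) (nbSum-*ˡ H (toℕ d) (ind ∘ S) v)

module FibreBounds (H : Graph) (nontrivial : Nontrivial H) where

  2≤s+weight : ∀ {s q} → ItalianWith H s q → weight H q ≤ 1 → 2 ≤ s + weight H q
  2≤s+weight {s} {q} italian w≤1 with sumFin≤1⇒∃≡0 (n H) nontrivial (toℕ ∘ q) w≤1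
  ... | v , qv≡0 = ≤-trans (italian v qv≡0) (+-monoʳ-≤ s (nbSum≤sumFin H (toℕ ∘ q) v))

  Admissible-fibre : ∀ {a b} →
    (∀ {s q} → ItalianWith H s q → weight H q ≡ 1 → a ≤ s) →
    (∀ {s q} → ItalianWith H s q → 2 ≤ weight H q → 2 + b ≤ weight H q + s) →
    ∀ q s → ItalianWith H s q → Admissible a b (weight H q) s
  Admissible-fibre {a} {b} weight1 weight≥2 q s italian = by-weight (weight H q) refl
    where
    by-weight : ∀ k → weight H q ≡ k → Admissible a b k s
    by-weight zero          w≡0 = subst (2 ≤_) (trans (cong (s +_) w≡0) (+-identityʳ s))
                                    (2≤s+weight italian (≤-trans (≤-reflexive w≡0) z≤n))
    by-weight (suc zero)    w≡1 = weight1 italian w≡1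
    by-weight (suc (suc k)) w≡k = ≤-pred (≤-pred (subst (λ w → 2 + b ≤ w + s) w≡k
                                    (weight≥2 italian (subst (2 ≤_) (≡-sym w≡k) (s≤s (s≤s z≤n))))))

  weight1⇒1≤s : ∀ {s q} → ItalianWith H s q → weight H q ≡ 1 → 1 ≤ s
  weight1⇒1≤s {s} italian w≡1 =
    +-cancelʳ-≤ 1 1 s (subst (λ w → 2 ≤ s + w) w≡1 (2≤s+weight italian (≤-reflexive w≡1)))

  weight1⇒2≤s : ∀ {g s q} → Gamma H g → 2 ≤ g → ItalianWith H s q → weight H q ≡ 1 → 2 ≤ s
  weight1⇒2≤s {s = s} γ 2≤g italian w≡1 with 2 ≤? s
  ... | yes 2≤s = 2≤s
  ... | no 2≰s  =
    ⊥-elim (1+n≰n (≤-trans 2≤g (≤-trans (γ≤weight H γ italian (≤-pred (≰⇒> 2≰s))) (≤-reflexive w≡1))))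

  weight≥2⇒3≤weight+s : ∀ {g g₂ s q} → Gamma H g → Gamma2 H g₂ → g < g₂ → g ≡ 2 →
    ItalianWith H s q → 2 ≤ weight H q → 3 ≤ weight H q + s
  weight≥2⇒3≤weight+s {s = s} {q} γ γ₂ g<g₂ refl italian 2≤w with 3 ≤? weight H q + s
  ... | yes 3≤w+s = 3≤w+s
  ... | no 3≰w+s  = ⊥-elim (<⇒≱ g<g₂ (≤-trans (γ₂≤weight H γ γ₂ italian₀ w≤2) w≤2))
    where
    w+s≤2 : weight H q + s ≤ 2
    w+s≤2 = ≤-pred (≰⇒> 3≰w+s)
    w≤2 : weight H q ≤ 2
    w≤2 = m+n≤o⇒m≤o (weight H q) w+s≤2
    italian₀ : ItalianWith H 0 q
    italian₀ = subst (λ t → ItalianWith H t q) (m≤n∧n+o≤m⇒o≡0 2≤w w+s≤2) italian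

  weight≥2⇒4≤weight+s : ∀ {g gI s q} → Gamma H g → GammaI H gI → 3 ≤ g → (gI ≢ 3 ⊎ g ≢ 3) →
    ItalianWith H s q → 2 ≤ weight H q → 4 ≤ weight H q + s
  weight≥2⇒4≤weight+s {g} {gI} {s} {q} γ γI 3≤g not-both-3 italian 2≤w with 4 ≤? weight H q + s
  ... | yes 4≤w+s = 4≤w+s
  ... | no 4≰w+s  = ⊥-elim ([ (λ gI≢3 → gI≢3 gI≡3) , (λ g≢3 → g≢3 g≡3) ]′ not-both-3)
    where
    w+s≤3 : weight H q + s ≤ 3
    w+s≤3 = ≤-pred (≰⇒> 4≰w+s)
    w≤3 : weight H q ≤ 3
    w≤3 = m+n≤o⇒m≤o (weight H q) w+s≤3
    g≤w : g ≤ weight H q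
    g≤w = γ≤weight H γ italian (+-cancelˡ-≤ 2 s 1 (≤-trans (+-monoˡ-≤ s 2≤w) w+s≤3))
    italian₀ : ItalianWith H 0 q
    italian₀ = subst (λ t → ItalianWith H t q) (m≤n∧n+o≤m⇒o≡0 (≤-trans 3≤g g≤w) w+s≤3) italian
    g≡3 : g ≡ 3
    g≡3 = ≤-antisym (≤-trans g≤w w≤3) 3≤g
    gI≡3 : gI ≡ 3
    gI≡3 = ≤-antisym (≤-trans (γI≤weight H γI italian₀) w≤3) (≤-trans 3≤g (γ≤γI H γ γI))

module Cases (G H : Graph) (noIso : NoIsolated G) (nontrivial : Nontrivial H) where
  open FibreBounds H nontrivial

  z : Fin (n H)
  z = fromℕ< (≤-trans (s≤s z≤n) nontrivial)

  isZ : Fin (n H) → Bool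
  isZ y = ⌊ y FP.≟ z ⌋

  setSize-isZ : setSize H isZ ≡ 1
  setSize-isZ = trans (sumFin-concentrated (n H) (ind ∘ isZ) z (λ y y≢z → cong ind (⌊≟⌋-≢ y≢z)))
                        (cong ind (⌊≟⌋-refl z))

  isZ-0-dominating : IsKDomSet 0 H isZ
  isZ-0-dominating _ _ = z≤n

  one two : Fin 3
  one = F.suc F.zero
  two = F.suc (F.suc F.zero)

  case-i : ∀ {g} → Gamma H g → g ≡ 1 → ∀ k → GammaI (G ∘L H) k ⇔ GammaW G (2 ∷ 1 ∷ 0 ∷ []) k
  case-i ((S , S-dom , size≡g) , _) g≡1 =
    Transfer.γI-∘L⇔γw G H noIso (s≤s z≤n) z≤n
      (Admissible-fibre weight1⇒1≤s (λ _ 2≤w → m≤n⇒m≤n+o _ 2≤w))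
      (kDomSet⇒FibrePattern H S-dom (trans size≡g g≡1) one)
      (kDomSet⇒FibrePattern H S-dom (trans size≡g g≡1) two)

  case-ii : ∀ {g g₂} → Gamma H g → Gamma2 H g₂ → g₂ ≡ 2 → g ≡ 2 →
    ∀ k → GammaI (G ∘L H) k ⇔ GammaW G (2 ∷ 2 ∷ 0 ∷ []) k
  case-ii γ ((T , T-dom , size≡g₂) , _) g₂≡2 g≡2 =
    Transfer.γI-∘L⇔γw G H noIso ≤-refl z≤n
      (Admissible-fibre (weight1⇒2≤s γ (≤-reflexive (≡-sym g≡2))) (λ _ 2≤w → m≤n⇒m≤n+o _ 2≤w))
      (kDomSet⇒FibrePattern H isZ-0-dominating setSize-isZ one)
      (kDomSet⇒FibrePattern H T-dom (trans size≡g₂ g₂≡2) one)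

  case-iii : ∀ {g g₂} → Gamma H g → Gamma2 H g₂ → g < g₂ → g ≡ 2 →
    ∀ k → GammaI (G ∘L H) k ⇔ GammaW G (2 ∷ 2 ∷ 1 ∷ []) k
  case-iii γ@((S , S-dom , size≡g) , _) γ₂ g<g₂ g≡2 =
    Transfer.γI-∘L⇔γw G H noIso ≤-refl (s≤s z≤n)
      (Admissible-fibre (weight1⇒2≤s γ (≤-reflexive (≡-sym g≡2)))
                        (weight≥2⇒3≤weight+s γ γ₂ g<g₂ g≡2))
      (kDomSet⇒FibrePattern H isZ-0-dominating setSize-isZ one)
      (kDomSet⇒FibrePattern H S-dom (trans size≡g g≡2) one)

  case-iv : ∀ {g gI} → Gamma H g → GammaI H gI → (gI ≢ 3 ⊎ g ≢ 3) → 3 ≤ g →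
    ∀ k → GammaI (G ∘L H) k ⇔ GammaW G (2 ∷ 2 ∷ 2 ∷ []) k
  case-iv γ γI not-both-3 3≤g =
    Transfer.γI-∘L⇔γw G H noIso ≤-refl ≤-refl
      (Admissible-fibre (weight1⇒2≤s γ (≤-trans (n≤1+n 2) 3≤g))
                        (weight≥2⇒4≤weight+s γ γI 3≤g not-both-3))
      (kDomSet⇒FibrePattern H isZ-0-dominating setSize-isZ one)
      (kDomSet⇒FibrePattern H isZ-0-dominating setSize-isZ two)

theorem2p2 : (G H : Graph) → NoIsolated G → Nontrivial H →
    (gI g g2 : ℕ) → GammaI H gI → Gamma H g → Gamma2 H g2 →
    (gI ≢ 3 ⊎ g ≢ 3) →
    ((g ≡ 1 → ∀ k → GammaI (G ∘L H) k ⇔ GammaW G (2 ∷ 1 ∷ 0 ∷ []) k)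
    × (g2 ≡ 2 → g ≡ 2 → ∀ k → GammaI (G ∘L H) k ⇔ GammaW G (2 ∷ 2 ∷ 0 ∷ []) k)
    × (g < g2 → g ≡ 2 → ∀ k → GammaI (G ∘L H) k ⇔ GammaW G (2 ∷ 2 ∷ 1 ∷ []) k)
    × (3 ≤ g → ∀ k → GammaI (G ∘L H) k ⇔ GammaW G (2 ∷ 2 ∷ 2 ∷ []) k))
theorem2p2 G H noIso nontrivial gI g g2 γI γ γ₂ not-both-3 =
  case-i γ , case-ii γ γ₂ , case-iii γ γ₂ , case-iv γ γI not-both-3
  where open Cases G H noIso nontrivial
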